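{- Let $\mathcal{C} = \operatorname{Av}(312, 213)$ and let $\pi, \tau \in \mathcal{C}$. Then $\operatorname{Av}_{\mathcal{C}}(\pi)$ and $\operatorname{Av}_{\mathcal{C}}(\tau)$ are Wilf-equivalent if and only if $|\pi| = |\tau|$.
   Context: Permutations are written in one-line notation. For permutations $\pi,\sigma$, $\pi \preceq \sigma$ ($\pi$ is involved in $\sigma$) if $\sigma$ has a subsequence with the same length as $\pi$ whose entries are in the same relative order as those of $\pi$; otherwise $\sigma$ avoids $\pi$. $\operatorname{Av}(X)$ is the set of all permutations avoiding every permutation in $X$. For a class $\mathcal{C}$ and $\pi\in\mathcal{C}$, $\operatorname{Av}_{\mathcal{C}}(\pi) = \mathcal{C} \cap \operatorname{Av}(\pi)$. Two permutation classes are Wilf-equivalent if, for every $n\ge 0$, they contain the same number of permutations of size $n$. -}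

module Defs where

open import Data.Nat using (ℕ; zero; suc; _+_)
open import Data.Fin using (Fin; zero; suc; _<_; _<?_)
open import Data.Fin.Properties using (_≟_; all?; any?)
open import Data.Vec using (Vec; []; _∷_; lookup)
open import Data.Product using (Σ; ∃; _×_; _,_; proj₁; proj₂)
open import Relation.Binary.PropositionalEquality using (_≡_)
open import Relation.Nullary using (Dec; yes; no; ¬_)
open import Relation.Nullary.Decidable using (_×-dec_; _→-dec_; ¬?; map′; does)
open import Data.Bool using (if_then_else_)
open import Relation.Unary using (Pred; Decidable)
open import Function.Bundles using (_⇔_; mk⇔)
import Function.Bundles
open import Data.Empty using (⊥-elim)

-- A word of length k over {0,…,n-1}, in one-line notation (0-indexed values).
-- A permutation of size k is such a word of length k over Fin k which is injective.
IsPerm : ∀ {k} → Vec (Fin k) k → Set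
IsPerm {k} v = ∀ (i j : Fin k) → lookup v i ≡ lookup v j → i ≡ j

Involved : ∀ {k n} → Vec (Fin k) k → Vec (Fin n) n → Set
Involved {k} {n} π σ =
  Σ (Vec (Fin n) k) λ e →
    (∀ (i j : Fin k) → i < j → lookup e i < lookup e j) ×
    (∀ (i j : Fin k) → (lookup π i < lookup π j) ⇔ (lookup σ (lookup e i) < lookup σ (lookup e j)))

Avoids : ∀ {k n} → Vec (Fin k) k → Vec (Fin n) n → Set
Avoids π σ = ¬ Involved π σ

p312 : Vec (Fin 3) 3
p312 = suc (suc zero) ∷ zero ∷ suc zero ∷ []

p213 : Vec (Fin 3) 3
p213 = suc zero ∷ zero ∷ suc (suc zero) ∷ []

InC : ∀ {n} → Vec (Fin n) n → Set
InC σ = IsPerm σ × Avoids p312 σ × Avoids p213 σ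

InAvC : ∀ {k n} → Vec (Fin k) k → Vec (Fin n) n → Set
InAvC π σ = InC σ × Avoids π σ

_⇔?_ : ∀ {A B : Set} → Dec A → Dec B → Dec (A ⇔ B)
yes a ⇔? yes b = yes (mk⇔ (λ _ → b) (λ _ → a))
yes a ⇔? no ¬b = no λ f → ¬b (Function.Bundles.Equivalence.to f a)
no ¬a ⇔? yes b = no λ f → ¬a (Function.Bundles.Equivalence.from f b)
no ¬a ⇔? no ¬b = yes (mk⇔ (λ a → ⊥-elim (¬a a)) (λ b → ⊥-elim (¬b b)))

anyVec? : ∀ {n k} {P : Vec (Fin n) k → Set} → (∀ v → Dec (P v)) → Dec (Σ (Vec (Fin n) k) P)
anyVec? {n} {zero} {P} P? with P? []
... | yes p = yes ([] , p)
... | no ¬p = no λ { ([] , p) → ¬p p }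
anyVec? {n} {suc k} {P} P? with any? (λ x → anyVec? {n} {k} {λ v → P (x ∷ v)} (λ v → P? (x ∷ v)))
... | yes (x , v , p) = yes (x ∷ v , p)
... | no ¬q = no λ { (x ∷ v , p) → ¬q (x , v , p) }

isPerm? : ∀ {k} (v : Vec (Fin k) k) → Dec (IsPerm v)
isPerm? v = all? λ i → all? λ j → (lookup v i ≟ lookup v j) →-dec (i ≟ j)

involved? : ∀ {k n} (π : Vec (Fin k) k) (σ : Vec (Fin n) n) → Dec (Involved π σ)
involved? π σ = anyVec? λ e →
  (all? λ i → all? λ j → (i <? j) →-dec (lookup e i <? lookup e j))
  ×-dec (all? λ i → all? λ j → (lookup π i <? lookup π j) ⇔? (lookup σ (lookup e i) <? lookup σ (lookup e j)))

avoids? : ∀ {k n} (π : Vec (Fin k) k) (σ : Vec (Fin n) n) → Dec (Avoids π σ)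
avoids? π σ = ¬? (involved? π σ)

inAvC? : ∀ {k n} (π : Vec (Fin k) k) (σ : Vec (Fin n) n) → Dec (InAvC π σ)
inAvC? π σ = (isPerm? σ ×-dec (avoids? p312 σ ×-dec avoids? p213 σ)) ×-dec avoids? π σ

sumFin : ∀ {n} → (Fin n → ℕ) → ℕ
sumFin {zero} f = 0
sumFin {suc n} f = f zero + sumFin (λ i → f (suc i))

countVec : ∀ {n k} {P : Vec (Fin n) k → Set} → (∀ v → Dec (P v)) → ℕ
countVec {n} {zero} P? = if does (P? []) then 1 else 0
countVec {n} {suc k} P? = sumFin {n} λ x → countVec {n} {k} (λ v → P? (x ∷ v))

numAvC : ∀ {k} → Vec (Fin k) k → ℕ → ℕ
numAvC π n = countVec {n} {n} (inAvC? π)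

WilfEquivAvC : ∀ {k m} → Vec (Fin k) k → Vec (Fin m) m → Set
WilfEquivAvC π τ = ∀ (n : ℕ) → numAvC π n ≡ numAvC τ n

-- A permutation of Av(312, 213) has its minimum at the first or the last position (otherwise the
-- first entry, the minimum and the last entry form a 213 or a 312), and removing it stays in the
-- class. If the pattern π has its minimum first, π = minFirst π′, then a text minFirst σ avoids π
-- iff σ avoids π′, while a text minLast σ avoids π iff σ avoids π; symmetrically when the minimum
-- of π is last. So |Av_C(π) ∩ S_{n+2}| = |Av_C(π′) ∩ S_{n+1}| + |Av_C(π) ∩ S_{n+1}|, a recursion
-- whose initial values depend on |π| only. The resulting numbers avCount k n are monotone in k and
-- strictly so at n = k, hence they determine k.
module Submission where

open import Defs
open import Data.Nat as ℕ using (ℕ; zero; suc; _+_; z≤n; z<s; s<s; s<s⁻¹)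
import Data.Nat.Properties as ℕ
open import Data.Fin using (Fin; zero; suc; _<_; fromℕ; punchIn; punchOut)
import Data.Fin.Properties as Fin
open import Data.Vec as Vec using (Vec; []; _∷_; lookup; insertAt; tabulate; allFin)
open import Data.Vec.Properties
  using (∷-injectiveʳ; insertAt-lookup; insertAt-punchIn; lookup-map; lookup∘tabulate; tabulate∘lookup;
         tabulate-cong; lookup-allFin)
open import Data.List using (List; []; _∷_; [_]; _++_; map; filter; length)
open import Data.List.Properties using (length-++; length-map; filter-++)
open import Data.List.Membership.Propositional using (_∈_)
open import Data.List.Membership.Propositional.Properties
  using (∈-map⁺; ∈-map⁻; ∈-++⁺ˡ; ∈-++⁺ʳ; ∈-++⁻; ∈-filter⁺; ∈-filter⁻)
open import Data.List.Membership.Propositional.Properties.WithK using (unique∧set⇒bag)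
open import Data.List.Relation.Binary.BagAndSetEquality using (∼bag⇒↭)
open import Data.List.Relation.Binary.Permutation.Propositional.Properties using (↭-length)
open import Data.List.Relation.Unary.All using ([])
open import Data.List.Relation.Unary.Any using (here)
open import Data.List.Relation.Unary.Unique.Propositional using (Unique; []; _∷_)
import Data.List.Relation.Unary.Unique.Propositional.Properties as Unique
open import Data.Product using (∃; _×_; _,_; proj₁; proj₂)
open import Data.Product.Function.NonDependent.Propositional using (_×-⇔_)
open import Data.Sum using (_⊎_; inj₁; inj₂)
open import Data.Bool using (true; false)
open import Data.Empty using (⊥; ⊥-elim)
open import Function using (_∘_)
open import Function.Bundles using (_⇔_; mk⇔; Equivalence)
open import Function.Properties.Equivalence using () renaming (refl to ⇔-refl; sym to ⇔-sym; trans to ⇔-trans)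
open import Relation.Binary.Definitions using (Tri; tri<; tri≈; tri>)
open import Relation.Binary.PropositionalEquality
  using (_≡_; _≢_; refl; sym; trans; cong; cong₂; subst; subst₂; module ≡-Reasoning)
open import Relation.Nullary using (Dec; yes; no; ¬_)
open import Relation.Nullary.Decidable using (does)

concatFin : ∀ {A : Set} n → (Fin n → List A) → List A
concatFin zero    f = []
concatFin (suc n) f = f zero ++ concatFin n (f ∘ suc)

allVecs : ∀ n k → List (Vec (Fin n) k)
allVecs n zero    = [ [] ]
allVecs n (suc k) = concatFin n λ x → map (x ∷_) (allVecs n k)

sumFin-cong : ∀ {n} {f g : Fin n → ℕ} → (∀ x → f x ≡ g x) → sumFin f ≡ sumFin g
sumFin-cong {zero}  f≗g = refl
sumFin-cong {suc n} f≗g = cong₂ _+_ (f≗g zero) (sumFin-cong (f≗g ∘ suc))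

module _ {A : Set} {P : A → Set} (P? : ∀ a → Dec (P a)) where

  length-filter-concatFin : ∀ n (f : Fin n → List A) →
    length (filter P? (concatFin n f)) ≡ sumFin (λ x → length (filter P? (f x)))
  length-filter-concatFin zero    f = refl
  length-filter-concatFin (suc n) f = begin
    length (filter P? (f zero ++ concatFin n (f ∘ suc)))
      ≡⟨ cong length (filter-++ P? (f zero) (concatFin n (f ∘ suc))) ⟩
    length (filter P? (f zero) ++ filter P? (concatFin n (f ∘ suc)))
      ≡⟨ length-++ (filter P? (f zero)) ⟩
    length (filter P? (f zero)) + length (filter P? (concatFin n (f ∘ suc)))
      ≡⟨ cong (length (filter P? (f zero)) +_) (length-filter-concatFin n (f ∘ suc)) ⟩
    sumFin (λ x → length (filter P? (f x)))
      ∎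
    where open ≡-Reasoning

  length-filter-map : ∀ {B : Set} (f : B → A) (xs : List B) →
    length (filter P? (map f xs)) ≡ length (filter (P? ∘ f) xs)
  length-filter-map f []       = refl
  length-filter-map f (x ∷ xs) with does (P? (f x))
  ... | true  = cong suc (length-filter-map f xs)
  ... | false = length-filter-map f xs

countVec≡length-filter-allVecs : ∀ {n k} {P : Vec (Fin n) k → Set} (P? : ∀ v → Dec (P v)) →
  countVec P? ≡ length (filter P? (allVecs n k))
countVec≡length-filter-allVecs {k = zero}  P? with does (P? [])
... | true  = refl
... | false = refl
countVec≡length-filter-allVecs {n} {suc k} P? = begin
  sumFin (λ x → countVec (P? ∘ (x ∷_)))
    ≡⟨ sumFin-cong (λ x → countVec≡length-filter-allVecs (P? ∘ (x ∷_))) ⟩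
  sumFin (λ x → length (filter (P? ∘ (x ∷_)) (allVecs n k)))
    ≡⟨ sumFin-cong (λ x → length-filter-map P? (x ∷_) (allVecs n k)) ⟨
  sumFin (λ x → length (filter P? (map (x ∷_) (allVecs n k))))
    ≡⟨ length-filter-concatFin P? n _ ⟨
  length (filter P? (allVecs n (suc k)))
    ∎
  where open ≡-Reasoning

module _ {A : Set} where

  ∈-concatFin⁺ : ∀ n (f : Fin n → List A) x {y} → y ∈ f x → y ∈ concatFin n f
  ∈-concatFin⁺ (suc n) f zero    y∈ = ∈-++⁺ˡ y∈
  ∈-concatFin⁺ (suc n) f (suc x) y∈ = ∈-++⁺ʳ (f zero) (∈-concatFin⁺ n (f ∘ suc) x y∈)

  ∈-concatFin⁻ : ∀ n (f : Fin n → List A) {y} → y ∈ concatFin n f → ∃ λ x → y ∈ f x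
  ∈-concatFin⁻ (suc n) f y∈ with ∈-++⁻ (f zero) y∈
  ... | inj₁ y∈f0 = zero , y∈f0
  ... | inj₂ y∈fs with ∈-concatFin⁻ n (f ∘ suc) y∈fs
  ...   | x , y∈fx = suc x , y∈fx

  concatFin-unique : ∀ n (f : Fin n → List A) → (∀ x → Unique (f x)) →
    (∀ {x x′ y} → y ∈ f x → y ∈ f x′ → x ≡ x′) → Unique (concatFin n f)
  concatFin-unique zero    f uniq disj = []
  concatFin-unique (suc n) f uniq disj =
    Unique.++⁺ (uniq zero)
      (concatFin-unique n (f ∘ suc) (uniq ∘ suc) (λ y∈ y∈′ → Fin.suc-injective (disj y∈ y∈′)))
      λ (y∈f0 , y∈fs) → Fin.0≢1+n (disj y∈f0 (proj₂ (∈-concatFin⁻ n (f ∘ suc) y∈fs)))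

∈-allVecs : ∀ {n k} (v : Vec (Fin n) k) → v ∈ allVecs n k
∈-allVecs []            = here refl
∈-allVecs {n} (x ∷ v) = ∈-concatFin⁺ n _ x (∈-map⁺ (x ∷_) (∈-allVecs v))

allVecs-unique : ∀ n k → Unique (allVecs n k)
allVecs-unique n zero    = [] ∷ []
allVecs-unique n (suc k) =
  concatFin-unique n _ (λ x → Unique.map⁺ ∷-injectiveʳ (allVecs-unique n k)) same-head
  where
  same-head : ∀ {x x′ : Fin n} {v} → v ∈ map (x ∷_) (allVecs n k) → v ∈ map (x′ ∷_) (allVecs n k) → x ≡ x′
  same-head v∈ v∈′ with ∈-map⁻ _ v∈ | ∈-map⁻ _ v∈′
  ... | _ , _ , refl | _ , _ , refl = refl

unique-∼set⇒length-≡ : ∀ {A : Set} {xs ys : List A} → Unique xs → Unique ys →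
  (∀ {z} → z ∈ xs → z ∈ ys) → (∀ {z} → z ∈ ys → z ∈ xs) → length xs ≡ length ys
unique-∼set⇒length-≡ uxs uys xs⊆ys ys⊆xs =
  ↭-length (∼bag⇒↭ (unique∧set⇒bag uxs uys (mk⇔ xs⊆ys ys⊆xs)))

module _ {n k m l} {P : Vec (Fin n) k → Set} {Q R : Vec (Fin m) l → Set}
  (P? : ∀ v → Dec (P v)) (Q? : ∀ u → Dec (Q u)) (R? : ∀ u → Dec (R u))
  (f g : Vec (Fin m) l → Vec (Fin n) k)
  (f-injective : ∀ {u u′} → f u ≡ f u′ → u ≡ u′) (g-injective : ∀ {u u′} → g u ≡ g u′ → u ≡ u′)
  (f≢g : ∀ u u′ → f u ≢ g u′)
  (P⇒f⊎g : ∀ v → P v → ∃ λ u → v ≡ f u ⊎ v ≡ g u)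
  (P∘f⇔Q : ∀ u → P (f u) ⇔ Q u) (P∘g⇔R : ∀ u → P (g u) ⇔ R u) where

  private
    Ps = filter P? (allVecs n k)
    fQs = map f (filter Q? (allVecs m l))
    gRs = map g (filter R? (allVecs m l))

    fQs-disjoint-gRs : ∀ {v} → v ∈ fQs → v ∈ gRs → ⊥
    fQs-disjoint-gRs v∈fQs v∈gRs with ∈-map⁻ f v∈fQs | ∈-map⁻ g v∈gRs
    ... | u , _ , refl | u′ , _ , eq = f≢g u u′ eq

    Ps⊆fQs++gRs : ∀ {v} → v ∈ Ps → v ∈ fQs ++ gRs
    Ps⊆fQs++gRs {v} v∈Ps with Pv ← proj₂ (∈-filter⁻ P? {xs = allVecs n k} v∈Ps) | P⇒f⊎g v Pv
    ... | u , inj₁ refl = ∈-++⁺ˡ (∈-map⁺ f (∈-filter⁺ Q? (∈-allVecs u) (Equivalence.to (P∘f⇔Q u) Pv)))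
    ... | u , inj₂ refl = ∈-++⁺ʳ fQs (∈-map⁺ g (∈-filter⁺ R? (∈-allVecs u) (Equivalence.to (P∘g⇔R u) Pv)))

    fQs++gRs⊆Ps : ∀ {v} → v ∈ fQs ++ gRs → v ∈ Ps
    fQs++gRs⊆Ps v∈ with ∈-++⁻ fQs v∈
    ... | inj₁ v∈fQs with u , u∈Qs , refl ← ∈-map⁻ f v∈fQs =
      ∈-filter⁺ P? (∈-allVecs _) (Equivalence.from (P∘f⇔Q u) (proj₂ (∈-filter⁻ Q? {xs = allVecs m l} u∈Qs)))
    ... | inj₂ v∈gRs with u , u∈Rs , refl ← ∈-map⁻ g v∈gRs =
      ∈-filter⁺ P? (∈-allVecs _) (Equivalence.from (P∘g⇔R u) (proj₂ (∈-filter⁻ R? {xs = allVecs m l} u∈Rs)))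

  countVec-split : countVec P? ≡ countVec Q? + countVec R?
  countVec-split = begin
    countVec P?                 ≡⟨ countVec≡length-filter-allVecs P? ⟩
    length Ps                   ≡⟨ unique-∼set⇒length-≡ uniquePs uniqueRHS Ps⊆fQs++gRs fQs++gRs⊆Ps ⟩
    length (fQs ++ gRs)         ≡⟨ length-++ fQs ⟩
    length fQs + length gRs
      ≡⟨ cong₂ _+_ (length-map f (filter Q? (allVecs m l))) (length-map g (filter R? (allVecs m l))) ⟩
    length (filter Q? (allVecs m l)) + length (filter R? (allVecs m l))
      ≡⟨ cong₂ _+_ (countVec≡length-filter-allVecs Q?) (countVec≡length-filter-allVecs R?) ⟨
    countVec Q? + countVec R?   ∎
    where
    open ≡-Reasoning
    uniquePs : Unique Ps
    uniquePs = Unique.filter⁺ P? (allVecs-unique n k)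
    uniqueRHS : Unique (fQs ++ gRs)
    uniqueRHS = Unique.++⁺ (Unique.map⁺ f-injective (Unique.filter⁺ Q? (allVecs-unique m l)))
                           (Unique.map⁺ g-injective (Unique.filter⁺ R? (allVecs-unique m l)))
                           λ (v∈fQs , v∈gRs) → fQs-disjoint-gRs v∈fQs v∈gRs

insertMin : ∀ {n} → Fin (suc n) → Vec (Fin n) n → Vec (Fin (suc n)) (suc n)
insertMin p σ = insertAt (Vec.map suc σ) p zero

minFirst : ∀ {n} → Vec (Fin n) n → Vec (Fin (suc n)) (suc n)
minFirst = insertMin zero

minLast : ∀ {n} → Vec (Fin n) n → Vec (Fin (suc n)) (suc n)
minLast {n} = insertMin (fromℕ n)

module _ {n} (p : Fin (suc n)) (σ : Vec (Fin n) n) where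

  lookup-insertMin-at : lookup (insertMin p σ) p ≡ zero
  lookup-insertMin-at = insertAt-lookup (Vec.map suc σ) p zero

  lookup-insertMin-punchIn : ∀ j → lookup (insertMin p σ) (punchIn p j) ≡ suc (lookup σ j)
  lookup-insertMin-punchIn j = trans (insertAt-punchIn (Vec.map suc σ) p zero j) (lookup-map j suc σ)

punchIn-cases : ∀ {n} (p x : Fin (suc n)) → x ≡ p ⊎ ∃ λ j → x ≡ punchIn p j
punchIn-cases p x with p Fin.≟ x
... | yes p≡x = inj₁ (sym p≡x)
... | no  p≢x = inj₂ (punchOut p≢x , sym (Fin.punchIn-punchOut p≢x))

lookup-ext : ∀ {A : Set} {n} (u v : Vec A n) → (∀ i → lookup u i ≡ lookup v i) → u ≡ v
lookup-ext u v u≗v = trans (sym (tabulate∘lookup u)) (trans (tabulate-cong u≗v) (tabulate∘lookup v))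

insertMin-injective : ∀ {n} (p : Fin (suc n)) {σ σ′ : Vec (Fin n) n} → insertMin p σ ≡ insertMin p σ′ → σ ≡ σ′
insertMin-injective p {σ} {σ′} eq = lookup-ext σ σ′ λ j → Fin.suc-injective (begin
  suc (lookup σ j)                     ≡⟨ lookup-insertMin-punchIn p σ j ⟨
  lookup (insertMin p σ) (punchIn p j)  ≡⟨ cong (λ τ → lookup τ (punchIn p j)) eq ⟩
  lookup (insertMin p σ′) (punchIn p j) ≡⟨ lookup-insertMin-punchIn p σ′ j ⟩
  suc (lookup σ′ j)                    ∎)
  where open ≡-Reasoning

minFirst≢minLast : ∀ {n} (σ σ′ : Vec (Fin (suc n)) (suc n)) → minFirst σ ≢ minLast σ′
minFirst≢minLast {n} σ σ′ eq =
  Fin.0≢1+n (trans (cong (λ τ → lookup τ zero) eq) (lookup-insertMin-punchIn (fromℕ (suc n)) σ′ zero))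

module _ {n} (p : Fin (suc n)) (σ : Vec (Fin n) n) where

  IsPerm-insertMin : IsPerm σ → IsPerm (insertMin p σ)
  IsPerm-insertMin σ-perm x y eq with punchIn-cases p x | punchIn-cases p y
  ... | inj₁ refl | inj₁ refl = refl
  ... | inj₁ refl | inj₂ (j , refl) =
    ⊥-elim (Fin.0≢1+n (trans (sym (lookup-insertMin-at p σ)) (trans eq (lookup-insertMin-punchIn p σ j))))
  ... | inj₂ (i , refl) | inj₁ refl =
    ⊥-elim (Fin.0≢1+n (trans (sym (lookup-insertMin-at p σ)) (trans (sym eq) (lookup-insertMin-punchIn p σ i))))
  ... | inj₂ (i , refl) | inj₂ (j , refl) = cong (punchIn p) (σ-perm i j (Fin.suc-injective (begin
    suc (lookup σ i)                     ≡⟨ lookup-insertMin-punchIn p σ i ⟨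
    lookup (insertMin p σ) (punchIn p i) ≡⟨ eq ⟩
    lookup (insertMin p σ) (punchIn p j) ≡⟨ lookup-insertMin-punchIn p σ j ⟩
    suc (lookup σ j)                     ∎)))
    where open ≡-Reasoning

  IsPerm-insertMin⁻ : IsPerm (insertMin p σ) → IsPerm σ
  IsPerm-insertMin⁻ perm i j eq = Fin.punchIn-injective p i j (perm _ _ (begin
    lookup (insertMin p σ) (punchIn p i) ≡⟨ lookup-insertMin-punchIn p σ i ⟩
    suc (lookup σ i)                     ≡⟨ cong suc eq ⟩
    suc (lookup σ j)                     ≡⟨ lookup-insertMin-punchIn p σ j ⟨
    lookup (insertMin p σ) (punchIn p j) ∎))
    where open ≡-Reasoning

-- An injective map Fin (suc n) → Fin (suc n) missing zero would inject into Fin n.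
IsPerm⇒∃zero : ∀ {n} (σ : Vec (Fin (suc n)) (suc n)) → IsPerm σ → ∃ λ p → lookup σ p ≡ zero
IsPerm⇒∃zero {n} σ perm with Fin.any? (λ p → lookup σ p Fin.≟ zero)
... | yes hit = hit
... | no miss = ⊥-elim (noCollision (Fin.pigeonhole (ℕ.n<1+n n) (λ x → punchOut (zero≢σ x))))
  where
  zero≢σ : ∀ x → zero ≢ lookup σ x
  zero≢σ x eq = miss (x , sym eq)
  noCollision : ¬ ∃ λ i → ∃ λ j → i < j × punchOut (zero≢σ i) ≡ punchOut (zero≢σ j)
  noCollision (i , j , i<j , eq) = Fin.<⇒≢ i<j (perm i j (Fin.punchOut-injective (zero≢σ i) (zero≢σ j) eq))

insertMin-surjective : ∀ {n} (σ : Vec (Fin (suc n)) (suc n)) → IsPerm σ →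
  ∀ p → lookup σ p ≡ zero → ∃ λ σ′ → σ ≡ insertMin p σ′
insertMin-surjective σ perm p σp≡0 = tabulate below , lookup-ext σ _ agree
  where
  zero≢σ∘punchIn : ∀ j → zero ≢ lookup σ (punchIn p j)
  zero≢σ∘punchIn j eq = Fin.punchInᵢ≢i p j (perm _ p (trans (sym eq) (sym σp≡0)))
  below : _ → _
  below j = punchOut (zero≢σ∘punchIn j)
  agree : ∀ x → lookup σ x ≡ lookup (insertMin p (tabulate below)) x
  agree x with punchIn-cases p x
  ... | inj₁ refl = trans σp≡0 (sym (lookup-insertMin-at p _))
  ... | inj₂ (j , refl) = begin
    lookup σ (punchIn p j)        ≡⟨ Fin.punchIn-punchOut (zero≢σ∘punchIn j) ⟨
    suc (below j)                 ≡⟨ cong suc (lookup∘tabulate below j) ⟨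
    suc (lookup (tabulate below) j) ≡⟨ lookup-insertMin-punchIn p _ j ⟨
    lookup (insertMin p (tabulate below)) (punchIn p j) ∎
    where open ≡-Reasoning

Increasing : ∀ {k n} → Vec (Fin n) k → Set
Increasing {k} e = ∀ (i j : Fin k) → i < j → lookup e i < lookup e j

SameOrder : ∀ {k n} → Vec (Fin k) k → Vec (Fin n) n → Vec (Fin n) k → Set
SameOrder {k} π σ e = ∀ (i j : Fin k) → (lookup π i < lookup π j) ⇔ (lookup σ (lookup e i) < lookup σ (lookup e j))

Occurrence : ∀ {k n} → Vec (Fin k) k → Vec (Fin n) n → Vec (Fin n) k → Set
Occurrence π σ e = Increasing e × SameOrder π σ e

suc-<-⇔ : ∀ {n} {a b : Fin n} → (a < b) ⇔ (suc a < suc b)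
suc-<-⇔ = mk⇔ s<s s<s⁻¹

punchIn-mono-< : ∀ {n} (p : Fin (suc n)) {i j : Fin n} → i < j → punchIn p i < punchIn p j
punchIn-mono-< p {i} {j} i<j =
  Fin.≤∧≢⇒< (Fin.punchIn-mono-≤ p i j (ℕ.<⇒≤ i<j)) (Fin.<⇒≢ i<j ∘ Fin.punchIn-injective p i j)

punchIn-cancel-< : ∀ {n} (p : Fin (suc n)) {i j : Fin n} → punchIn p i < punchIn p j → i < j
punchIn-cancel-< p {i} {j} lt =
  Fin.≤∧≢⇒< (Fin.punchIn-cancel-≤ p i j (ℕ.<⇒≤ lt)) (Fin.<⇒≢ lt ∘ cong (punchIn p))

punchOut-mono-< : ∀ {n} {p i j : Fin (suc n)} (p≢i : p ≢ i) (p≢j : p ≢ j) → i < j → punchOut p≢i < punchOut p≢j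
punchOut-mono-< p≢i p≢j i<j =
  Fin.≤∧≢⇒< (Fin.punchOut-mono-≤ p≢i p≢j (ℕ.<⇒≤ i<j)) (Fin.<⇒≢ i<j ∘ Fin.punchOut-injective p≢i p≢j)

punchIn-fromℕ-< : ∀ {n} (j : Fin n) → punchIn (fromℕ n) j < fromℕ n
punchIn-fromℕ-< zero    = z<s
punchIn-fromℕ-< (suc j) = s<s (punchIn-fromℕ-< j)

occurrence-id : ∀ {k} (π : Vec (Fin k) k) → Occurrence π π (allFin k)
occurrence-id π = inc , same
  where
  inc : Increasing (allFin _)
  inc i j i<j rewrite lookup-allFin i | lookup-allFin j = i<j
  same : SameOrder π π (allFin _)
  same i j rewrite lookup-allFin i | lookup-allFin j = ⇔-refl

occurrence-∘ : ∀ {l k n} {π′ : Vec (Fin l) l} {π : Vec (Fin k) k} {σ : Vec (Fin n) n} ρ e →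
  Occurrence π′ π ρ → Occurrence π σ e → Occurrence π′ σ (Vec.map (lookup e) ρ)
occurrence-∘ {π′ = π′} {σ = σ} ρ e (ρ-inc , ρ-same) (e-inc , e-same) = inc , same
  where
  inc : Increasing (Vec.map (lookup e) ρ)
  inc i j i<j rewrite lookup-map i (lookup e) ρ | lookup-map j (lookup e) ρ = e-inc _ _ (ρ-inc i j i<j)
  same : SameOrder π′ σ (Vec.map (lookup e) ρ)
  same i j rewrite lookup-map i (lookup e) ρ | lookup-map j (lookup e) ρ = ⇔-trans (ρ-same i j) (e-same _ _)

module _ {k n} (π : Vec (Fin k) k) (σ : Vec (Fin n) n) (p : Fin (suc n)) where

  occurrence-insertMin⁺ : ∀ e → Occurrence π σ e → Occurrence π (insertMin p σ) (Vec.map (punchIn p) e)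
  occurrence-insertMin⁺ e (inc , same) = inc′ , same′
    where
    inc′ : Increasing (Vec.map (punchIn p) e)
    inc′ i j i<j rewrite lookup-map i (punchIn p) e | lookup-map j (punchIn p) e = punchIn-mono-< p (inc i j i<j)
    same′ : SameOrder π (insertMin p σ) (Vec.map (punchIn p) e)
    same′ i j rewrite lookup-map i (punchIn p) e | lookup-map j (punchIn p) e
                    | lookup-insertMin-punchIn p σ (lookup e i) | lookup-insertMin-punchIn p σ (lookup e j)
                    = ⇔-trans (same i j) suc-<-⇔

  involved-insertMin⁺ : Involved π σ → Involved π (insertMin p σ)
  involved-insertMin⁺ (e , occ) = Vec.map (punchIn p) e , occurrence-insertMin⁺ e occ

  occurrence-at-insertion⇒minimal : ∀ e → Occurrence π (insertMin p σ) e →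
    ∀ {i j} → lookup e j ≡ p → ¬ (lookup π i < lookup π j)
  occurrence-at-insertion⇒minimal e (_ , same) {i} {j} ej≡p πi<πj =
    ℕ.n≮0 (subst (lookup (insertMin p σ) (lookup e i) <_)
                 (trans (cong (lookup (insertMin p σ)) ej≡p) (lookup-insertMin-at p σ))
                 (Equivalence.to (same i j) πi<πj))

  involved-insertMin⁻ : ∀ e → Occurrence π (insertMin p σ) e → (∀ j → p ≢ lookup e j) → Involved π σ
  involved-insertMin⁻ e (inc , same) p∉e = tabulate e′ , inc′ , same′
    where
    e′ : Fin k → Fin n
    e′ j = punchOut (p∉e j)
    lookup-e : ∀ j → lookup (insertMin p σ) (lookup e j) ≡ suc (lookup σ (e′ j))
    lookup-e j = trans (cong (lookup (insertMin p σ)) (sym (Fin.punchIn-punchOut (p∉e j))))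
                       (lookup-insertMin-punchIn p σ (e′ j))
    inc′ : Increasing (tabulate e′)
    inc′ i j i<j rewrite lookup∘tabulate e′ i | lookup∘tabulate e′ j = punchOut-mono-< (p∉e i) (p∉e j) (inc i j i<j)
    same′ : SameOrder π σ (tabulate e′)
    same′ i j rewrite lookup∘tabulate e′ i | lookup∘tabulate e′ j =
      ⇔-trans (subst₂ (λ a b → (lookup π i < lookup π j) ⇔ (a < b)) (lookup-e i) (lookup-e j) (same i j))
              (⇔-sym suc-<-⇔)

involved-insertMin-insertMin⁻ : ∀ {k n} (π : Vec (Fin k) k) (σ : Vec (Fin n) n) (q : Fin (suc k)) (p : Fin (suc n)) →
  Involved (insertMin q π) (insertMin p σ) → Involved π σ
involved-insertMin-insertMin⁻ π σ q p (E , occ) = involved-insertMin⁻ π σ p (Vec.map (lookup E) ρ) occ′ p∉e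
  where
  ρ = Vec.map (punchIn q) (allFin _)
  occ′ : Occurrence π (insertMin p σ) (Vec.map (lookup E) ρ)
  occ′ = occurrence-∘ {π′ = π} {insertMin q π} {insertMin p σ} ρ E
           (occurrence-insertMin⁺ π π q (allFin _) (occurrence-id π)) occ
  lookup-e : ∀ j → lookup (Vec.map (lookup E) ρ) j ≡ lookup E (punchIn q j)
  lookup-e j = trans (lookup-map j (lookup E) ρ)
                     (cong (lookup E) (trans (lookup-map j (punchIn q) (allFin _)) (cong (punchIn q) (lookup-allFin j))))
  -- every entry of π lies above the new minimum of insertMin q π, so it cannot be matched at p
  p∉e : ∀ j → p ≢ lookup (Vec.map (lookup E) ρ) j
  p∉e j p≡ej = occurrence-at-insertion⇒minimal (insertMin q π) σ p E occ {q} {punchIn q j}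
    (sym (trans p≡ej (lookup-e j)))
    (subst₂ _<_ (sym (lookup-insertMin-at q π)) (sym (lookup-insertMin-punchIn q π j)) z<s)

SameSide : ∀ {k n} → Fin (suc k) → Fin (suc n) → Set
SameSide q p = (∀ j x → q < punchIn q j → p < punchIn p x) × (∀ j x → punchIn q j < q → punchIn p x < p)

sameSide-zero : ∀ {k n} → SameSide {k} {n} zero zero
sameSide-zero = (λ _ _ _ → z<s) , (λ _ _ ())

sameSide-fromℕ : ∀ {k n} → SameSide (fromℕ k) (fromℕ n)
sameSide-fromℕ = (λ j _ q<j → ⊥-elim (Fin.<-asym q<j (punchIn-fromℕ-< j))) , (λ _ x _ → punchIn-fromℕ-< x)

involved-insertMin-insertMin⁺ : ∀ {k n} (π : Vec (Fin k) k) (σ : Vec (Fin n) n) {q : Fin (suc k)} {p : Fin (suc n)} →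
  SameSide q p → Involved π σ → Involved (insertMin q π) (insertMin p σ)
involved-insertMin-insertMin⁺ {k} {n} π σ {q} {p} (above , below) (e , inc , same) = E , incE , sameE
  where
  E : Vec (Fin (suc n)) (suc k)
  E = insertAt (Vec.map (punchIn p) e) q p
  E-at : lookup E q ≡ p
  E-at = insertAt-lookup (Vec.map (punchIn p) e) q p
  E-punchIn : ∀ j → lookup E (punchIn q j) ≡ punchIn p (lookup e j)
  E-punchIn j = trans (insertAt-punchIn (Vec.map (punchIn p) e) q p j) (lookup-map j (punchIn p) e)
  incE : Increasing E
  incE i j i<j with punchIn-cases q i | punchIn-cases q j
  ... | inj₁ refl | inj₁ refl = ⊥-elim (Fin.<-irrefl refl i<j)
  ... | inj₁ refl | inj₂ (j′ , refl) rewrite E-at | E-punchIn j′ = above j′ (lookup e j′) i<j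
  ... | inj₂ (i′ , refl) | inj₁ refl rewrite E-at | E-punchIn i′ = below i′ (lookup e i′) i<j
  ... | inj₂ (i′ , refl) | inj₂ (j′ , refl) rewrite E-punchIn i′ | E-punchIn j′ =
    punchIn-mono-< p (inc i′ j′ (punchIn-cancel-< q i<j))
  sameE : SameOrder (insertMin q π) (insertMin p σ) E
  sameE i j with punchIn-cases q i | punchIn-cases q j
  ... | inj₁ refl | inj₁ refl = mk⇔ (⊥-elim ∘ Fin.<-irrefl refl) (⊥-elim ∘ Fin.<-irrefl refl)
  ... | inj₁ refl | inj₂ (j′ , refl)
    rewrite E-at | E-punchIn j′ | lookup-insertMin-at q π | lookup-insertMin-punchIn q π j′
          | lookup-insertMin-at p σ | lookup-insertMin-punchIn p σ (lookup e j′) = mk⇔ (λ _ → z<s) (λ _ → z<s)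
  ... | inj₂ (i′ , refl) | inj₁ refl
    rewrite E-at | E-punchIn i′ | lookup-insertMin-at q π | lookup-insertMin-punchIn q π i′
          | lookup-insertMin-at p σ | lookup-insertMin-punchIn p σ (lookup e i′) = mk⇔ (⊥-elim ∘ ℕ.n≮0) (⊥-elim ∘ ℕ.n≮0)
  ... | inj₂ (i′ , refl) | inj₂ (j′ , refl)
    rewrite E-punchIn i′ | E-punchIn j′ | lookup-insertMin-punchIn q π i′ | lookup-insertMin-punchIn q π j′
          | lookup-insertMin-punchIn p σ (lookup e i′) | lookup-insertMin-punchIn p σ (lookup e j′) =
    ⇔-trans (⇔-sym suc-<-⇔) (⇔-trans (same i′ j′) suc-<-⇔)

increasing-at-zero : ∀ {k n} (e : Vec (Fin (suc n)) (suc k)) → Increasing e → ∀ j → lookup e j ≡ zero → j ≡ zero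
increasing-at-zero e inc zero    _     = refl
increasing-at-zero e inc (suc j) ej≡0 = ⊥-elim (ℕ.n≮0 (subst (lookup e zero <_) ej≡0 (inc zero (suc j) z<s)))

increasing-at-fromℕ : ∀ {k n} (e : Vec (Fin (suc n)) (suc k)) → Increasing e →
  ∀ j → lookup e j ≡ fromℕ n → j ≡ fromℕ k
increasing-at-fromℕ {k} e inc j ej≡max with j Fin.≟ fromℕ k
... | yes j≡max = j≡max
... | no  j≢max = ⊥-elim (ℕ.<-irrefl refl (ℕ.<-≤-trans (subst (_< lookup e (fromℕ k)) ej≡max e-j<e-max) (Fin.≤fromℕ _)))
  where
  e-j<e-max : lookup e j < lookup e (fromℕ k)
  e-j<e-max = inc j (fromℕ k) (Fin.≤∧≢⇒< (Fin.≤fromℕ j) j≢max)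

avoids-insertMin : ∀ {k n} (π : Vec (Fin k) k) (σ : Vec (Fin n) n) (p : Fin (suc n)) (j₀ : Fin k) →
  (∀ e → Increasing e → ∀ j → lookup e j ≡ p → j ≡ j₀) → (∃ λ i → lookup π i < lookup π j₀) →
  Avoids π σ → Avoids π (insertMin p σ)
avoids-insertMin π σ p j₀ only-j₀ (i , πi<πj₀) π⋠σ (e , occ) =
  π⋠σ (involved-insertMin⁻ π σ p e occ λ j p≡ej →
    occurrence-at-insertion⇒minimal π σ p e occ (sym p≡ej)
      (subst (λ j → lookup π i < lookup π j) (sym (only-j₀ e (proj₁ occ) j (sym p≡ej))) πi<πj₀))

avoids-minFirst : ∀ {k n} (π : Vec (Fin (suc k)) (suc k)) (σ : Vec (Fin n) n) →
  (∃ λ i → lookup π i < lookup π zero) → Avoids π σ → Avoids π (minFirst σ)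
avoids-minFirst π σ = avoids-insertMin π σ zero zero increasing-at-zero

avoids-minLast : ∀ {k n} (π : Vec (Fin (suc k)) (suc k)) (σ : Vec (Fin n) n) →
  (∃ λ i → lookup π i < lookup π (fromℕ k)) → Avoids π σ → Avoids π (minLast σ)
avoids-minLast {k} π σ = avoids-insertMin π σ _ (fromℕ k) increasing-at-fromℕ

involved-by-monotone : ∀ {k n} (π : Vec (Fin k) k) (σ : Vec (Fin n) n) (e : Vec (Fin n) k) → Increasing e →
  (h : Fin k → Fin n) → (∀ x y → x < y → h x < h y) → (∀ i → lookup σ (lookup e i) ≡ h (lookup π i)) →
  Involved π σ
involved-by-monotone π σ e inc h h-mono σ∘e≡h∘π = e , inc , same
  where
  h-reflects : ∀ {x y} → h x < h y → x < y
  h-reflects {x} {y} hx<hy with Fin.<-cmp x y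
  ... | tri< x<y _ _ = x<y
  ... | tri≈ _ x≡y _ = ⊥-elim (Fin.<-irrefl (cong h x≡y) hx<hy)
  ... | tri> _ _ y<x = ⊥-elim (Fin.<-asym hx<hy (h-mono _ _ y<x))
  same : SameOrder π σ e
  same i j rewrite σ∘e≡h∘π i | σ∘e≡h∘π j = mk⇔ (h-mono _ _) h-reflects

increasing₃ : ∀ {n} {a b c : Fin n} → a < b → b < c → Increasing (a ∷ b ∷ c ∷ [])
increasing₃ a<b b<c zero             (suc zero)       _ = a<b
increasing₃ a<b b<c zero             (suc (suc zero)) _ = Fin.<-trans a<b b<c
increasing₃ a<b b<c (suc zero)       (suc (suc zero)) _ = b<c
increasing₃ a<b b<c zero             zero             ()
increasing₃ a<b b<c (suc zero)       zero             ()
increasing₃ a<b b<c (suc zero)       (suc zero)       (s<s ())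
increasing₃ a<b b<c (suc (suc zero)) zero             ()
increasing₃ a<b b<c (suc (suc zero)) (suc zero)       (s<s ())
increasing₃ a<b b<c (suc (suc zero)) (suc (suc zero)) (s<s (s<s ()))

InC-min-at-end : ∀ {n} (σ : Vec (Fin (suc n)) (suc n)) → InC σ →
  ∀ {p} → lookup σ p ≡ zero → p ≡ zero ⊎ p ≡ fromℕ n
InC-min-at-end {n} σ (perm , σ⋡312 , σ⋡213) {p} σp≡0 with p Fin.≟ zero | p Fin.≟ fromℕ n
... | yes p≡0 | _         = inj₁ p≡0
... | _       | yes p≡max = inj₂ p≡max
... | no p≢0  | no p≢max  = ⊥-elim (first-vs-last (Fin.<-cmp (lookup σ zero) (lookup σ max)))
  where
  max = fromℕ n
  0<p : zero {n} < p
  0<p = Fin.≤∧≢⇒< z≤n (p≢0 ∘ sym)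
  p<max : p < max
  p<max = Fin.≤∧≢⇒< (Fin.≤fromℕ p) p≢max
  positive : ∀ {x} → x ≢ p → zero {n} < lookup σ x
  positive x≢p = Fin.≤∧≢⇒< z≤n λ 0≡σx → x≢p (perm _ p (trans (sym 0≡σx) (sym σp≡0)))
  e = zero ∷ p ∷ max ∷ []
  e-inc : Increasing e
  e-inc = increasing₃ 0<p p<max
  first-vs-last : Tri (lookup σ zero < lookup σ max) (lookup σ zero ≡ lookup σ max) (lookup σ max < lookup σ zero) → ⊥
  first-vs-last (tri< first<last _ _) =
    σ⋡213 (involved-by-monotone p213 σ e e-inc (lookup (zero ∷ lookup σ zero ∷ lookup σ max ∷ []))
      (increasing₃ (positive (p≢0 ∘ sym)) first<last) λ { zero → refl ; (suc zero) → σp≡0 ; (suc (suc zero)) → refl })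
  first-vs-last (tri≈ _ first≡last _) = Fin.<-irrefl (perm zero max first≡last) (Fin.<-trans 0<p p<max)
  first-vs-last (tri> _ _ last<first) =
    σ⋡312 (involved-by-monotone p312 σ e e-inc (lookup (zero ∷ lookup σ max ∷ lookup σ zero ∷ []))
      (increasing₃ (positive (p≢max ∘ sym)) last<first) λ { zero → refl ; (suc zero) → σp≡0 ; (suc (suc zero)) → refl })

InC-insertMin⁻ : ∀ {n} (p : Fin (suc n)) (σ : Vec (Fin n) n) → InC (insertMin p σ) → InC σ
InC-insertMin⁻ p σ (perm , σ⋡312 , σ⋡213) =
  IsPerm-insertMin⁻ p σ perm , σ⋡312 ∘ involved-insertMin⁺ p312 σ p , σ⋡213 ∘ involved-insertMin⁺ p213 σ p

InC-minFirst⇔ : ∀ {n} (σ : Vec (Fin n) n) → InC (minFirst σ) ⇔ InC σ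
InC-minFirst⇔ σ = mk⇔ (InC-insertMin⁻ zero σ) λ (perm , σ⋡312 , σ⋡213) →
  IsPerm-insertMin zero σ perm ,
  avoids-minFirst p312 σ (suc zero , z<s) σ⋡312 , avoids-minFirst p213 σ (suc zero , z<s) σ⋡213

InC-minLast⇔ : ∀ {n} (σ : Vec (Fin n) n) → InC (minLast σ) ⇔ InC σ
InC-minLast⇔ {n} σ = mk⇔ (InC-insertMin⁻ (fromℕ n) σ) λ (perm , σ⋡312 , σ⋡213) →
  IsPerm-insertMin (fromℕ n) σ perm ,
  avoids-minLast p312 σ (suc zero , z<s) σ⋡312 , avoids-minLast p213 σ (suc zero , z<s) σ⋡213

InC-decompose : ∀ {n} (σ : Vec (Fin (suc n)) (suc n)) → InC σ → ∃ λ σ′ → σ ≡ minFirst σ′ ⊎ σ ≡ minLast σ′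
InC-decompose σ σ∈C@(perm , _) with p , σp≡0 ← IsPerm⇒∃zero σ perm
                              with σ′ , σ≡ ← insertMin-surjective σ perm p σp≡0
                              with InC-min-at-end σ σ∈C {p} σp≡0
... | inj₁ refl = σ′ , inj₁ σ≡
... | inj₂ refl = σ′ , inj₂ σ≡

module _ {k n} (π : Vec (Fin k) k) (σ : Vec (Fin n) n) where

  avoids-minFirst-minFirst : Avoids (minFirst π) (minFirst σ) ⇔ Avoids π σ
  avoids-minFirst-minFirst = mk⇔ (λ av → av ∘ involved-insertMin-insertMin⁺ π σ sameSide-zero)
                                 (λ av → av ∘ involved-insertMin-insertMin⁻ π σ zero zero)

  avoids-minLast-minLast : Avoids (minLast π) (minLast σ) ⇔ Avoids π σ
  avoids-minLast-minLast = mk⇔ (λ av → av ∘ involved-insertMin-insertMin⁺ π σ sameSide-fromℕ)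
                               (λ av → av ∘ involved-insertMin-insertMin⁻ π σ (fromℕ k) (fromℕ n))

module _ {k n} (π : Vec (Fin (suc k)) (suc k)) (σ : Vec (Fin n) n) where

  avoids-minFirst-minLast : Avoids (minFirst π) (minLast σ) ⇔ Avoids (minFirst π) σ
  avoids-minFirst-minLast = mk⇔ (λ av → av ∘ involved-insertMin⁺ (minFirst π) σ (fromℕ n))
    (avoids-minLast (minFirst π) σ (zero , first<last))
    where
    first<last : lookup (minFirst π) zero < lookup (minFirst π) (fromℕ (suc k))
    first<last = subst (zero {suc k} <_) (sym (lookup-insertMin-punchIn zero π (fromℕ k))) z<s

  avoids-minLast-minFirst : Avoids (minLast π) (minFirst σ) ⇔ Avoids (minLast π) σ
  avoids-minLast-minFirst = mk⇔ (λ av → av ∘ involved-insertMin⁺ (minLast π) σ zero)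
    (avoids-minFirst (minLast π) σ (fromℕ (suc k) , last<first))
    where
    last<first : lookup (minLast π) (fromℕ (suc k)) < lookup (minLast π) zero
    last<first = subst₂ _<_ (sym (lookup-insertMin-at (fromℕ (suc k)) π))
                            (sym (lookup-insertMin-punchIn (fromℕ (suc k)) π zero)) z<s

countVec-[] : ∀ {n} {P : Vec (Fin n) 0 → Set} (P? : ∀ v → Dec (P v)) → P [] → countVec P? ≡ 1
countVec-[] P? P[] with P? []
... | yes _   = refl
... | no ¬P[] = ⊥-elim (¬P[] P[])

countVec-none : ∀ {n k} {P : Vec (Fin n) k → Set} (P? : ∀ v → Dec (P v)) → (∀ v → ¬ P v) → countVec P? ≡ 0
countVec-none {k = zero}  P? ¬P with P? []
... | yes P[] = ⊥-elim (¬P [] P[])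
... | no _    = refl
countVec-none {k = suc k} P? ¬P = sumFin-zero λ x → countVec-none (P? ∘ (x ∷_)) (¬P ∘ (x ∷_))
  where
  sumFin-zero : ∀ {n} {f : Fin n → ℕ} → (∀ x → f x ≡ 0) → sumFin f ≡ 0
  sumFin-zero {zero}  f≡0 = refl
  sumFin-zero {suc n} f≡0 = cong₂ _+_ (f≡0 zero) (sumFin-zero (f≡0 ∘ suc))

numAvC-suc : ∀ {k ka kb n} (π : Vec (Fin k) k) (πa : Vec (Fin ka) ka) (πb : Vec (Fin kb) kb) →
  (∀ (σ : Vec (Fin (suc n)) (suc n)) → Avoids π (minFirst σ) ⇔ Avoids πa σ) →
  (∀ (σ : Vec (Fin (suc n)) (suc n)) → Avoids π (minLast σ) ⇔ Avoids πb σ) →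
  numAvC π (suc (suc n)) ≡ numAvC πa (suc n) + numAvC πb (suc n)
numAvC-suc π πa πb first⇔ last⇔ =
  countVec-split (inAvC? π) (inAvC? πa) (inAvC? πb) minFirst minLast
    (insertMin-injective zero) (insertMin-injective (fromℕ _)) minFirst≢minLast
    (λ σ (σ∈C , _) → InC-decompose σ σ∈C)
    (λ σ → InC-minFirst⇔ σ ×-⇔ first⇔ σ) (λ σ → InC-minLast⇔ σ ×-⇔ last⇔ σ)

numAvC-minFirst : ∀ {k} n (π : Vec (Fin (suc k)) (suc k)) →
  numAvC (minFirst π) (suc (suc n)) ≡ numAvC π (suc n) + numAvC (minFirst π) (suc n)
numAvC-minFirst n π = numAvC-suc {n = n} (minFirst π) π (minFirst π) (avoids-minFirst-minFirst π) (avoids-minFirst-minLast π)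

numAvC-minLast : ∀ {k} n (π : Vec (Fin (suc k)) (suc k)) →
  numAvC (minLast π) (suc (suc n)) ≡ numAvC (minLast π) (suc n) + numAvC π (suc n)
numAvC-minLast n π = numAvC-suc {n = n} (minLast π) (minLast π) π (avoids-minLast-minFirst π) (avoids-minLast-minLast π)

-- cong (λ ρ → numAvC ρ n) would make Agda evaluate the counts while type checking.
numAvC-cong : ∀ {k} n (π π′ : Vec (Fin k) k) → π ≡ π′ → numAvC π n ≡ numAvC π′ n
numAvC-cong n π π′ refl = refl

-- avCount (k + 1) (n + 1) = Σ_{i<k} (n choose i)
avCount : ℕ → ℕ → ℕ
avCount zero          n             = 0
avCount (suc k)       zero          = 1
avCount (suc zero)    (suc n)       = 0
avCount (suc (suc k)) (suc zero)    = 1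
avCount (suc (suc k)) (suc (suc n)) = avCount (suc k) (suc n) + avCount (suc (suc k)) (suc n)

numAvC≡avCount-step : ∀ n {k} (π : Vec (Fin (suc (suc k))) (suc (suc k))) → InC π →
  (∀ {k′} (ρ : Vec (Fin k′) k′) → InC ρ → numAvC ρ (suc n) ≡ avCount k′ (suc n)) →
  numAvC π (suc (suc n)) ≡ avCount (suc (suc k)) (suc (suc n))
numAvC≡avCount-step n {k} π π∈C numAvC≡avCount-suc = by-decomposition (InC-decompose π π∈C)
  where
  open ≡-Reasoning
  by-decomposition : (∃ λ π′ → π ≡ minFirst π′ ⊎ π ≡ minLast π′) →
    numAvC π (suc (suc n)) ≡ avCount (suc (suc k)) (suc (suc n))
  by-decomposition (π′ , inj₁ π≡) = begin
    numAvC π (suc (suc n))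
      ≡⟨ numAvC-cong (suc (suc n)) π (minFirst π′) π≡ ⟩
    numAvC (minFirst π′) (suc (suc n))
      ≡⟨ numAvC-minFirst n π′ ⟩
    numAvC π′ (suc n) + numAvC (minFirst π′) (suc n)
      ≡⟨ cong₂ _+_ (numAvC≡avCount-suc π′ (InC-insertMin⁻ zero π′ minFirst-π′∈C))
                   (numAvC≡avCount-suc (minFirst π′) minFirst-π′∈C) ⟩
    avCount (suc k) (suc n) + avCount (suc (suc k)) (suc n)
      ∎
    where
    minFirst-π′∈C : InC (minFirst π′)
    minFirst-π′∈C = subst InC π≡ π∈C
  by-decomposition (π′ , inj₂ π≡) = begin
    numAvC π (suc (suc n))
      ≡⟨ numAvC-cong (suc (suc n)) π (minLast π′) π≡ ⟩
    numAvC (minLast π′) (suc (suc n))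
      ≡⟨ numAvC-minLast n π′ ⟩
    numAvC (minLast π′) (suc n) + numAvC π′ (suc n)
      ≡⟨ cong₂ _+_ (numAvC≡avCount-suc (minLast π′) minLast-π′∈C)
                   (numAvC≡avCount-suc π′ (InC-insertMin⁻ (fromℕ (suc k)) π′ minLast-π′∈C)) ⟩
    avCount (suc (suc k)) (suc n) + avCount (suc k) (suc n)
      ≡⟨ ℕ.+-comm (avCount (suc (suc k)) (suc n)) (avCount (suc k) (suc n)) ⟩
    avCount (suc k) (suc n) + avCount (suc (suc k)) (suc n)
      ∎
    where
    minLast-π′∈C : InC (minLast π′)
    minLast-π′∈C = subst InC π≡ π∈C

numAvC≡avCount : ∀ n {k} (π : Vec (Fin k) k) → InC π → numAvC π n ≡ avCount k n
numAvC≡avCount n [] _ = countVec-none {n} {n} (inAvC? []) λ σ (_ , σ⋡[]) → σ⋡[] ([] , (λ ()) , (λ ()))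
numAvC≡avCount zero (x ∷ π) _ = countVec-[] (inAvC? (x ∷ π)) (empty∈C , λ { (() ∷ _ , _) })
  where
  empty∈C : InC []
  empty∈C = (λ ()) , (λ { (() ∷ _ , _) }) , (λ { (() ∷ _ , _) })
numAvC≡avCount (suc n) (x ∷ []) _ =
  countVec-none {suc n} {suc n} (inAvC? (x ∷ [])) λ σ (_ , σ⋡x) →
    σ⋡x (zero ∷ [] , (λ { zero zero () }) ,
         λ { zero zero → mk⇔ (⊥-elim ∘ Fin.<-irrefl refl) (⊥-elim ∘ Fin.<-irrefl refl) })
numAvC≡avCount (suc zero) {suc (suc k)} π _ =
  cong (_+ 0) (countVec-[] (inAvC? π ∘ (zero ∷_)) (singleton∈C , too-long π))
  where
  too-long : ∀ {k} (π : Vec (Fin (suc (suc k))) (suc (suc k))) → Avoids π (zero ∷ [])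
  too-long π (zero ∷ zero ∷ _ , inc , _) = ℕ.<-irrefl refl (inc zero (suc zero) z<s)
  singleton∈C : InC (zero ∷ [])
  singleton∈C = (λ { zero zero _ → refl }) , too-long p312 , too-long p213
numAvC≡avCount (suc (suc n)) {suc (suc k)} π π∈C = numAvC≡avCount-step n π π∈C (numAvC≡avCount (suc n))

avCount-mono-suc : ∀ k n → avCount k n ℕ.≤ avCount (suc k) n
avCount-mono-suc zero          n             = z≤n
avCount-mono-suc (suc k)       zero          = ℕ.≤-refl
avCount-mono-suc (suc zero)    (suc n)       = z≤n
avCount-mono-suc (suc (suc k)) (suc zero)    = ℕ.≤-refl
avCount-mono-suc (suc (suc k)) (suc (suc n)) =
  ℕ.+-mono-≤ (avCount-mono-suc (suc k) (suc n)) (avCount-mono-suc (suc (suc k)) (suc n))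

avCount-monoˡ-≤ : ∀ n {k m} → k ℕ.≤ m → avCount k n ℕ.≤ avCount m n
avCount-monoˡ-≤ n {m = zero}  z≤n = ℕ.≤-refl
avCount-monoˡ-≤ n {m = suc m} k≤1+m with ℕ.m≤n⇒m<n∨m≡n k≤1+m
... | inj₁ (s<s k≤m) = ℕ.≤-trans (avCount-monoˡ-≤ n k≤m) (avCount-mono-suc m n)
... | inj₂ refl      = ℕ.≤-refl

avCount-diagonal-< : ∀ k → avCount k k ℕ.< avCount (suc k) k
avCount-diagonal-< zero          = z<s
avCount-diagonal-< (suc zero)    = z<s
avCount-diagonal-< (suc (suc k)) = begin-strict
  avCount (suc (suc k)) (suc (suc k))
    ≡⟨ ℕ.+-comm (avCount (suc k) (suc k)) (avCount (suc (suc k)) (suc k)) ⟩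
  avCount (suc (suc k)) (suc k) + avCount (suc k) (suc k)
    <⟨ ℕ.+-monoʳ-< (avCount (suc (suc k)) (suc k)) (avCount-diagonal-< (suc k)) ⟩
  avCount (suc (suc k)) (suc k) + avCount (suc (suc k)) (suc k)
    ≤⟨ ℕ.+-monoʳ-≤ (avCount (suc (suc k)) (suc k)) (avCount-mono-suc (suc (suc k)) (suc k)) ⟩
  avCount (suc (suc (suc k))) (suc (suc k))
    ∎
  where open ℕ.≤-Reasoning

-- For k < m the counts already differ at size k.
avCount-injective : ∀ {k m} → (∀ n → avCount k n ≡ avCount m n) → k ≡ m
avCount-injective {k} {m} same with ℕ.<-cmp k m
... | tri≈ _ k≡m _ = k≡m
... | tri< k<m _ _ = ⊥-elim (ℕ.<-irrefl (same k) (ℕ.<-≤-trans (avCount-diagonal-< k) (avCount-monoˡ-≤ k k<m)))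
... | tri> _ _ m<k = ⊥-elim (ℕ.<-irrefl (sym (same m)) (ℕ.<-≤-trans (avCount-diagonal-< m) (avCount-monoˡ-≤ m m<k)))

mainTheorem3 : ∀ (k m : ℕ) (π : Vec (Fin k) k) (τ : Vec (Fin m) m) →
    InC π → InC τ →
    (WilfEquivAvC π τ ⇔ (k ≡ m))
mainTheorem3 k m π τ π∈C τ∈C = mk⇔
  (λ wilf → avCount-injective λ n → begin
     avCount k n ≡⟨ numAvC≡avCount n π π∈C ⟨
     numAvC π n  ≡⟨ wilf n ⟩
     numAvC τ n  ≡⟨ numAvC≡avCount n τ τ∈C ⟩
     avCount m n ∎)
  (λ { refl n → trans (numAvC≡avCount n π π∈C) (sym (numAvC≡avCount n τ τ∈C)) })
  where open ≡-Reasoning
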